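{- Let $f:\mathbb{N}\to\mathbb{N}$ be increasing with $f(0)>0$, and let $\tau,\tau'$ be types and $t,t'\in\mathbb{N}$. 1. If $k\in\tau$, then $\tau_{\langle k,t\rangle}<_m\tau$. 2. If $k\in\tau$ and $\tau\subseteq\tau'$, then $\tau_{\langle k,t\rangle}\subseteq\tau'_{\langle k,t\rangle}$. 3. If $\{k,l\}\subseteq\tau$, then $\tau_{\langle l,t\rangle\langle k,t'\rangle}=\tau_{\langle k,t'\rangle\langle l,t\rangle}$. 4. If $\{k,l\}\subseteq\tau$ with $k\le l$ and $t\le t'$, then $\tau_{\langle l,t\rangle\langle k,t'\rangle}\sqsubseteq\tau_{\langle k,t\rangle\langle l,t'\rangle}$. 5. If $\tau\sqsubseteq\tau'$ and $k\in\tau$, then there exists $l\in\tau'$ with $k\le l$ and $\tau_{\langle k,t\rangle}\sqsubseteq\tau'_{\langle l,t\rangle}$.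
   Context: A type is a finite multiset of natural numbers, with multiset sum, difference and scaling ($p\times\{m\}$ is $m$ with multiplicity $p$). $N_k(t)=k\cdot(f(t)-1)$; for $k\in\tau$, $\tau_{\langle k,t\rangle}=\tau-\{k\}+N_k(t)\times\{k-1\}$ (for $k=0$, $\tau-\{0\}$); $\tau_{\langle l,t\rangle\langle k,t'\rangle}$ means $(\tau_{\langle l,t\rangle})_{\langle k,t'\rangle}$. Inclusion: $\tau_1\subseteq\tau_2$ iff $\tau_2=\tau_1+\tau'$ for some $\tau'$. The multiset ordering $<_m$ is the transitive relation generated by $\tau<_m\{k\}$ whenever $k>l$ for all $l\in\tau$, and $\tau_1+\tau<_m\tau_2+\tau$ whenever $\tau_1<_m\tau_2$. The dominance ordering: writing elements in decreasing order, $\{a_1,\dots,a_n\}\sqsubseteq\{b_1,\dots,b_m\}$ iff $n\le m$ and $a_i\le b_i$ for all $i\le n$. -}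

module Defs where

open import Data.Nat using (ℕ; zero; suc; _+_; _*_; _∸_; _≤_; _<_; _≟_)
open import Data.Nat.Properties using (≤-decTotalOrder)
open import Data.List using (List; []; _∷_; _++_; replicate; reverse; [_])
open import Data.List.Relation.Unary.All using (All)
open import Data.List.Relation.Binary.Permutation.Propositional using (_↭_)
open import Data.Product using (∃)
open import Relation.Nullary using (yes; no)
import Data.List.Sort

-- A type (finite multiset of naturals) is represented by a list;
-- multiset equality is permutation _↭_.
Type : Set
Type = List ℕ

remove : ℕ → Type → Type
remove k [] = []
remove k (x ∷ xs) with k ≟ x
... | yes _ = xs
... | no  _ = x ∷ remove k xs

N : (ℕ → ℕ) → ℕ → ℕ → ℕ
N f k t = k * (f t ∸ 1)

-- τ_{⟨k,t⟩} = τ - {k} + N_k(t) × {k-1}   (for k = 0 this is τ - {0})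
step : (ℕ → ℕ) → ℕ → ℕ → Type → Type
step f zero    t τ = remove zero τ
step f (suc k) t τ = remove (suc k) τ ++ replicate (N f (suc k) t) k

_⊆ₘ_ : Type → Type → Set
τ₁ ⊆ₘ τ₂ = ∃ λ τ' → τ₂ ↭ (τ₁ ++ τ')

-- Multiset ordering: transitive relation generated by the two rules,
-- taken on multisets (i.e. closed under multiset equality ↭).
data _<ₘ_ : Type → Type → Set where
  single : ∀ {τ k} → All (_< k) τ → τ <ₘ [ k ]
  add    : ∀ {τ₁ τ₂} τ → τ₁ <ₘ τ₂ → (τ₁ ++ τ) <ₘ (τ₂ ++ τ)
  trans  : ∀ {τ₁ τ₂ τ₃} → τ₁ <ₘ τ₂ → τ₂ <ₘ τ₃ → τ₁ <ₘ τ₃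
  perm   : ∀ {τ₁ τ₂ σ₁ σ₂} → τ₁ ↭ σ₁ → τ₂ ↭ σ₂ → σ₁ <ₘ σ₂ → τ₁ <ₘ τ₂

module S = Data.List.Sort ≤-decTotalOrder

sortDesc : Type → List ℕ
sortDesc τ = reverse (S.sort τ)

data Dom : List ℕ → List ℕ → Set where
  []  : ∀ {bs} → Dom [] bs
  _∷_ : ∀ {a b as bs} → a ≤ b → Dom as bs → Dom (a ∷ as) (b ∷ bs)

_⊑_ : Type → Type → Set
τ₁ ⊑ τ₂ = Dom (sortDesc τ₁) (sortDesc τ₂)

Increasing : (ℕ → ℕ) → Set
Increasing f = ∀ {m n} → m < n → f m < f n

module Submission where

-- (a) Up to permutation a step replaces one occurrence of k by a list
--     spawn f k t of copies of k - 1: if τ ↭ k ∷ ρ then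
--     step f k t τ ↭ ρ ++ spawn f k t.  Parts 1, 2 and 3 are bookkeeping
--     with permutations once this is known (part 1 because every element of
--     spawn f k t is below k).
--
-- (b) The dominance ordering is a comparison of threshold counts: writing
--     count≥ x τ for the number of elements of τ that are at least x,
--     τ₁ ⊑ τ₂ holds iff count≥ x τ₁ ≤ count≥ x τ₂ for every x.  Counts are
--     additive and invariant under permutation, so parts 4 and 5 become
--     inequalities between natural numbers: part 4 is a rearrangement
--     inequality between the counts of the spawned lists, and in part 5 the
--     element l is the point where the count function of τ' drops to the
--     value count≥ (k + 1) τ.

open import Defs
open import Data.Nat using (ℕ; _≤_; _<_)
open import Data.List using (_∷_; [])
open import Data.List.Membership.Propositional using (_∈_)
open import Data.List.Relation.Binary.Permutation.Propositional using (_↭_)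
open import Data.Product using (_×_; ∃)

open import Data.Nat using (zero; suc; _+_; _*_; _∸_; _≥_; _≤?_; _<?_; _≟_; s≤s; s≤s⁻¹; z≤n)
open import Data.Nat.Properties
open import Data.Nat.Tactic.RingSolver using (solve-∀)
open import Data.Nat.ListAction using (sum)
open import Data.List using (List; _++_; length; filter; replicate; reverse)
open import Data.List.Properties using (filter-accept; filter-reject; filter-all; filter-none; filter-++; length-++; length-replicate; unfold-reverse)
open import Data.List.Relation.Unary.All as All using (All; []; _∷_)
open import Data.List.Relation.Unary.All.Properties using (replicate⁺)
open import Data.List.Relation.Unary.AllPairs using (AllPairs; []; _∷_)
import Data.List.Relation.Unary.AllPairs.Properties as AllPairs
open import Data.List.Relation.Unary.Linked.Properties using (Linked⇒AllPairs)
open import Data.List.Relation.Unary.Any using (here; there)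
open import Data.List.Relation.Binary.Sublist.Propositional using (⊆-refl)
open import Data.List.Relation.Binary.Sublist.Propositional.Properties using (filter⁺; length-mono-≤)
open import Data.List.Relation.Binary.Permutation.Propositional using (↭-refl; ↭-sym; ↭-trans; prep; swap; module PermutationReasoning)
open import Data.List.Relation.Binary.Permutation.Propositional.Properties using (drop-∷; ∈-resp-↭; ↭-length; filter-↭; ++⁺ˡ; ++⁺ʳ; ++-assoc; ++-comm; ↭-reverse; All-resp-↭)
open import Data.Product using (_,_)
open import Data.Sum using (inj₁; inj₂)
open import Relation.Nullary using (yes; no; contradiction)
open import Relation.Binary using (tri<; tri≈; tri>; _Preserves_⟶_)
open import Relation.Binary.PropositionalEquality using (_≡_; refl; sym; cong; subst; subst₂; module ≡-Reasoning)
  renaming (trans to ≡-trans)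

private
  variable
    x y k l : ℕ
    xs ys τ τ' ρ σ : List ℕ

remove-↭ : k ∈ τ → τ ↭ k ∷ remove k τ
remove-↭ {k} {y ∷ τ} k∈τ with k ≟ y
... | yes refl = ↭-refl
... | no k≢y with k∈τ
...   | here k≡y = contradiction k≡y k≢y
...   | there k∈τ' = ↭-trans (prep y (remove-↭ k∈τ')) (swap y k ↭-refl)

remove-cancel : τ ↭ k ∷ ρ → remove k τ ↭ ρ
remove-cancel τ↭kρ =
  drop-∷ (↭-trans (↭-sym (remove-↭ (∈-resp-↭ (↭-sym τ↭kρ) (here refl)))) τ↭kρ)

count≥ : ℕ → List ℕ → ℕ
count≥ x τ = length (filter (x ≤?_) τ)

count≥-accept : ∀ ys → x ≤ y → count≥ x (y ∷ ys) ≡ suc (count≥ x ys)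
count≥-accept {x} _ x≤y = cong length (filter-accept (x ≤?_) x≤y)

count≥-reject : ∀ ys → y < x → count≥ x (y ∷ ys) ≡ count≥ x ys
count≥-reject {y} {x} _ y<x = cong length (filter-reject (x ≤?_) (<⇒≱ y<x))

count≥-∷ : count≥ x ys ≤ count≥ x (y ∷ ys)
count≥-∷ {x} {ys} {y} with x ≤? y
... | yes x≤y = ≤-trans (n≤1+n _) (≤-reflexive (sym (count≥-accept ys x≤y)))
... | no x≰y = ≤-reflexive (sym (count≥-reject ys (≰⇒> x≰y)))

count≥-self : ∀ x xs → 0 < count≥ x (x ∷ xs)
count≥-self x xs = subst (0 <_) (sym (count≥-accept xs (≤-refl {x}))) (s≤s z≤n)

count≥-++ : ∀ x xs ys → count≥ x (xs ++ ys) ≡ count≥ x xs + count≥ x ys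
count≥-++ x xs ys = begin
  length (filter (x ≤?_) (xs ++ ys))                       ≡⟨ cong length (filter-++ (x ≤?_) xs ys) ⟩
  length (filter (x ≤?_) xs ++ filter (x ≤?_) ys)           ≡⟨ length-++ (filter (x ≤?_) xs) ⟩
  count≥ x xs + count≥ x ys                                 ∎
  where open ≡-Reasoning

count≥-↭ : xs ↭ ys → count≥ x xs ≡ count≥ x ys
count≥-↭ {x = x} p = ↭-length (filter-↭ (x ≤?_) p)

count≥-antitone : ∀ τ → x ≤ y → count≥ y τ ≤ count≥ x τ
count≥-antitone {x} {y} τ x≤y =
  length-mono-≤ (filter⁺ (y ≤?_) (x ≤?_) (λ { refl y≤z → ≤-trans x≤y y≤z }) (⊆-refl {x = τ}))

count≥-all : All (x ≤_) τ → count≥ x τ ≡ length τ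
count≥-all {x} p = cong length (filter-all (x ≤?_) p)

count≥-none : All (_< x) τ → count≥ x τ ≡ 0
count≥-none {x} p = cong length (filter-none (x ≤?_) (All.map <⇒≱ p))

count≥-beyond-sum : ∀ τ → count≥ (suc (sum τ)) τ ≡ 0
count≥-beyond-sum τ = count≥-none (below-sum τ)
  where
  below-sum : ∀ τ → All (_< suc (sum τ)) τ
  below-sum [] = []
  below-sum (y ∷ ys) = s≤s (m≤m+n y (sum ys))
    ∷ All.map (λ z<s → ≤-trans z<s (s≤s (m≤n+m (sum ys) y))) (below-sum ys)

count≥-remove-below : k ∈ τ → x ≤ k → count≥ x τ ≡ suc (count≥ x (remove k τ))
count≥-remove-below {k} {τ} {x} k∈τ x≤k =
  ≡-trans (count≥-↭ {x = x} (remove-↭ k∈τ)) (count≥-accept (remove k τ) x≤k)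

count≥-remove-above : k ∈ τ → k < x → count≥ x τ ≡ count≥ x (remove k τ)
count≥-remove-above {k} {τ} {x} k∈τ k<x =
  ≡-trans (count≥-↭ {x = x} (remove-↭ k∈τ)) (count≥-reject (remove k τ) k<x)

∈⇒count≥-drops : l ∈ τ → count≥ (suc l) τ < count≥ l τ
∈⇒count≥-drops {l} {τ} l∈τ = begin-strict
  count≥ (suc l) τ                ≡⟨ count≥-remove-above l∈τ ≤-refl ⟩
  count≥ (suc l) (remove l τ)     ≤⟨ count≥-antitone (remove l τ) (n≤1+n l) ⟩
  count≥ l (remove l τ)           <⟨ n<1+n _ ⟩
  suc (count≥ l (remove l τ))     ≡⟨ count≥-remove-below l∈τ ≤-refl ⟨
  count≥ l τ                      ∎
  where open ≤-Reasoning

count≥-drops⇒∈ : ∀ τ → count≥ (suc l) τ < count≥ l τ → l ∈ τ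
count≥-drops⇒∈ [] ()
count≥-drops⇒∈ {l} (y ∷ τ) drop with <-cmp l y
... | tri≈ _ l≡y _ = here l≡y
... | tri< l<y _ _ = there (count≥-drops⇒∈ τ (s≤s⁻¹
      (subst₂ _<_ (count≥-accept τ l<y) (count≥-accept τ (<⇒≤ l<y)) drop)))
... | tri> _ _ y<l = there (count≥-drops⇒∈ τ
      (subst₂ _<_ (count≥-reject τ (m<n⇒m<1+n y<l)) (count≥-reject τ y<l) drop))

_≼_ : List ℕ → List ℕ → Set
τ₁ ≼ τ₂ = ∀ x → count≥ x τ₁ ≤ count≥ x τ₂

≼-resp-↭ : ∀ {τ₁ τ₂ σ₁ σ₂} → τ₁ ↭ σ₁ → τ₂ ↭ σ₂ → σ₁ ≼ σ₂ → τ₁ ≼ τ₂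
≼-resp-↭ p q σ₁≼σ₂ x = subst₂ _≤_ (sym (count≥-↭ p)) (sym (count≥-↭ q)) (σ₁≼σ₂ x)

≼-++ : ∀ {τ₁ τ₂ σ₁ σ₂} → τ₁ ≼ τ₂ → σ₁ ≼ σ₂ → (τ₁ ++ σ₁) ≼ (τ₂ ++ σ₂)
≼-++ {τ₁} {τ₂} {σ₁} {σ₂} τ≼ σ≼ x =
  subst₂ _≤_ (sym (count≥-++ x τ₁ σ₁)) (sym (count≥-++ x τ₂ σ₂)) (+-mono-≤ (τ≼ x) (σ≼ x))

Dom⇒≼ : Dom xs ys → xs ≼ ys
Dom⇒≼ [] x = z≤n
Dom⇒≼ {a ∷ as} {b ∷ bs} (a≤b ∷ d) x with x ≤? a
... | yes x≤a = subst₂ _≤_ (sym (count≥-accept as x≤a)) (sym (count≥-accept bs (≤-trans x≤a a≤b)))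
                  (s≤s (Dom⇒≼ d x))
... | no x≰a = subst (_≤ count≥ x (b ∷ bs)) (sym (count≥-reject as (≰⇒> x≰a)))
                 (≤-trans (Dom⇒≼ d x) (count≥-∷ {ys = bs}))

-- For decreasingly sorted lists the converse holds: if some aᵢ > bᵢ, the
-- threshold aᵢ is met i times on the right but at least i + 1 times on the left.
≼⇒Dom : AllPairs _≥_ xs → AllPairs _≥_ ys → xs ≼ ys → Dom xs ys
≼⇒Dom [] _ _ = []
≼⇒Dom {a ∷ as} (_ ∷ _) [] xs≼ys = contradiction (xs≼ys a) (<⇒≱ (count≥-self a as))
≼⇒Dom {a ∷ as} {b ∷ bs} (as≤a ∷ as↓) (bs≤b ∷ bs↓) xs≼ys =
  a≤b ∷ ≼⇒Dom as↓ bs↓ tails≼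
  where
  a≤b : a ≤ b
  a≤b = ≮⇒≥ λ b<a → contradiction
    (subst (count≥ a (a ∷ as) ≤_) (count≥-none (b<a ∷ All.map (λ c≤b → ≤-<-trans c≤b b<a) bs≤b)) (xs≼ys a))
    (<⇒≱ (count≥-self a as))
  tails≼ : as ≼ bs
  tails≼ x with x ≤? a
  ... | yes x≤a = s≤s⁻¹ (subst₂ _≤_ (count≥-accept as x≤a) (count≥-accept bs (≤-trans x≤a a≤b)) (xs≼ys x))
  ... | no x≰a = subst (_≤ count≥ x bs) (sym (count≥-none (All.map (λ c≤a → ≤-<-trans c≤a (≰⇒> x≰a)) as≤a))) z≤n

reverse-descending : AllPairs _≤_ xs → AllPairs _≥_ (reverse xs)
reverse-descending [] = []
reverse-descending {x ∷ xs} (x≤xs ∷ xs↑) rewrite unfold-reverse x xs =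
  AllPairs.++⁺ (reverse-descending xs↑) ([] ∷ [])
    (All.map (λ x≤y → x≤y ∷ []) (All-resp-↭ (↭-sym (↭-reverse xs)) x≤xs))

sortDesc-↭ : ∀ τ → sortDesc τ ↭ τ
sortDesc-↭ τ = ↭-trans (↭-reverse (S.sort τ)) (S.sort-↭ τ)

sortDesc-descending : ∀ τ → AllPairs _≥_ (sortDesc τ)
sortDesc-descending τ = reverse-descending (Linked⇒AllPairs ≤-trans (S.sort-↗ τ))

⊑⇒≼ : τ ⊑ τ' → τ ≼ τ'
⊑⇒≼ {τ} {τ'} τ⊑τ' = ≼-resp-↭ (↭-sym (sortDesc-↭ τ)) (↭-sym (sortDesc-↭ τ')) (Dom⇒≼ τ⊑τ')

≼⇒⊑ : τ ≼ τ' → τ ⊑ τ'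
≼⇒⊑ {τ} {τ'} τ≼τ' =
  ≼⇒Dom (sortDesc-descending τ) (sortDesc-descending τ') (≼-resp-↭ (sortDesc-↭ τ) (sortDesc-↭ τ') τ≼τ')

spawn : (ℕ → ℕ) → ℕ → ℕ → List ℕ
spawn f zero    t = []
spawn f (suc k) t = replicate (N f (suc k) t) k

spawn-below : ∀ f k t → All (_< k) (spawn f k t)
spawn-below f zero    t = []
spawn-below f (suc k) t = replicate⁺ (N f (suc k) t) ≤-refl

step-normal : ∀ f k t τ → step f k t τ ↭ remove k τ ++ spawn f k t
step-normal f zero    t τ = ↭-sym (++-comm (remove zero τ) [])
step-normal f (suc k) t τ = ↭-refl

step-cancel : ∀ f t → τ ↭ k ∷ ρ → step f k t τ ↭ ρ ++ spawn f k t
step-cancel {τ} {k} f t τ↭kρ = ↭-trans (step-normal f k t τ) (++⁺ʳ (spawn f k t) (remove-cancel τ↭kρ))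

steps-cancel : ∀ f {a b} r s → τ ↭ a ∷ b ∷ σ →
  step f b s (step f a r τ) ↭ (σ ++ spawn f a r) ++ spawn f b s
steps-cancel f r s τ↭abσ = step-cancel f s (step-cancel f r τ↭abσ)

swap-tail : ∀ (ρ a b : List ℕ) → (ρ ++ a) ++ b ↭ (ρ ++ b) ++ a
swap-tail ρ a b = ↭-trans (++-assoc ρ a b) (↭-trans (++⁺ˡ ρ (++-comm a b)) (↭-sym (++-assoc ρ b a)))

-- Part 1: a step replaces k by smaller elements, a generating decrease of <ₘ.
step-decreases : ∀ f t → k ∈ τ → step f k t τ <ₘ τ
step-decreases {k} {τ} f t k∈τ =
  perm (↭-trans (step-normal f k t τ) (++-comm (remove k τ) (spawn f k t))) (remove-↭ k∈τ)
       (add (remove k τ) (single (spawn-below f k t)))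

-- Part 2: a step at an element of τ acts on τ + σ as on τ, leaving σ alone.
step-⊆ₘ : ∀ f t → k ∈ τ → τ ⊆ₘ τ' → step f k t τ ⊆ₘ step f k t τ'
step-⊆ₘ {k} {τ} {τ'} f t k∈τ (σ , τ'↭τσ) = σ , (begin
  step f k t τ'                          ↭⟨ step-cancel f t (↭-trans τ'↭τσ (++⁺ʳ σ (remove-↭ k∈τ))) ⟩
  (remove k τ ++ σ) ++ spawn f k t       ↭⟨ swap-tail (remove k τ) σ (spawn f k t) ⟩
  (remove k τ ++ spawn f k t) ++ σ       ↭⟨ ++⁺ʳ σ (step-normal f k t τ) ⟨
  step f k t τ ++ σ                      ∎)
  where open PermutationReasoning

steps-commute : ∀ f {k l} t t' → τ ↭ k ∷ l ∷ σ →
  step f k t' (step f l t τ) ↭ step f l t (step f k t' τ)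
steps-commute {τ} {σ} f {k} {l} t t' τ↭klσ = begin
  step f k t' (step f l t τ)             ↭⟨ steps-cancel f t t' (↭-trans τ↭klσ (swap k l ↭-refl)) ⟩
  (σ ++ spawn f l t) ++ spawn f k t'     ↭⟨ swap-tail σ (spawn f l t) (spawn f k t') ⟩
  (σ ++ spawn f k t') ++ spawn f l t     ↭⟨ steps-cancel f t' t τ↭klσ ⟨
  step f l t (step f k t' τ)             ∎
  where open PermutationReasoning

count≥-spawn-below : ∀ f t → x < k → count≥ x (spawn f k t) ≡ N f k t
count≥-spawn-below {k = suc k} f t (s≤s x≤k) =
  ≡-trans (count≥-all (replicate⁺ (N f (suc k) t) x≤k)) (length-replicate (N f (suc k) t))

count≥-spawn-above : ∀ f t → k ≤ x → count≥ x (spawn f k t) ≡ 0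
count≥-spawn-above {k = zero} f t  _   = refl
count≥-spawn-above {k = suc k} f t k<x = count≥-none (replicate⁺ (N f (suc k) t) k<x)

rearrangement : ∀ {K L a b} → K ≤ L → a ≤ b → L * a + K * b ≤ K * a + L * b
rearrangement {K} {a = a} {b} K≤L a≤b with m≤n⇒∃[o]m+o≡n K≤L
... | D , refl = begin
  (K + D) * a + K * b      ≡⟨ regroup₁ K D a b ⟩
  K * a + K * b + D * a    ≤⟨ +-monoʳ-≤ (K * a + K * b) (*-monoʳ-≤ D a≤b) ⟩
  K * a + K * b + D * b    ≡⟨ regroup₂ K D a b ⟩
  K * a + (K + D) * b      ∎
  where
  open ≤-Reasoning
  regroup₁ : ∀ K D a b → (K + D) * a + K * b ≡ K * a + K * b + D * a
  regroup₁ = solve-∀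
  regroup₂ : ∀ K D a b → K * a + K * b + D * b ≡ K * a + (K + D) * b
  regroup₂ = solve-∀

spawn-≼ : ∀ f t → k ≤ l → spawn f k t ≼ spawn f l t
spawn-≼ {k} {l} f t k≤l x with x <? k
... | yes x<k rewrite count≥-spawn-below f t x<k | count≥-spawn-below f t (<-≤-trans x<k k≤l) =
  *-monoˡ-≤ (f t ∸ 1) k≤l
... | no x≮k rewrite count≥-spawn-above f t (≮⇒≥ x≮k) = z≤n

-- At a
-- threshold x < k this is the rearrangement inequality, for k ≤ x < l it is
-- monotonicity of N in t, and for l ≤ x both sides vanish.
spawn-exchange : ∀ f → f Preserves _≤_ ⟶ _≤_ → ∀ {k l t t'} → k ≤ l → t ≤ t' →
  (spawn f l t ++ spawn f k t') ≼ (spawn f k t ++ spawn f l t')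
spawn-exchange f f-mono {k} {l} {t} {t'} k≤l t≤t' x
  rewrite count≥-++ x (spawn f l t) (spawn f k t') | count≥-++ x (spawn f k t) (spawn f l t')
  with x <? k | x <? l
... | yes x<k | _
  rewrite count≥-spawn-below f t x<k | count≥-spawn-below f t' x<k
        | count≥-spawn-below f t (<-≤-trans x<k k≤l) | count≥-spawn-below f t' (<-≤-trans x<k k≤l) =
  rearrangement k≤l (∸-monoˡ-≤ 1 (f-mono t≤t'))
... | no x≮k | yes x<l
  rewrite count≥-spawn-above f t (≮⇒≥ x≮k) | count≥-spawn-above f t' (≮⇒≥ x≮k)
        | count≥-spawn-below f t x<l | count≥-spawn-below f t' x<l
        | +-identityʳ (N f l t) =
  *-monoʳ-≤ l (∸-monoˡ-≤ 1 (f-mono t≤t'))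
... | no x≮k | no x≮l
  rewrite count≥-spawn-above f t (≮⇒≥ x≮k) | count≥-spawn-above f t' (≮⇒≥ x≮k)
        | count≥-spawn-above f t (≮⇒≥ x≮l) | count≥-spawn-above f t' (≮⇒≥ x≮l) = z≤n

-- Part 4: both sides are σ plus two spawns, compared by spawn-exchange.
steps-exchange : ∀ f → f Preserves _≤_ ⟶ _≤_ → ∀ {k l} t t' →
  τ ↭ k ∷ l ∷ σ → k ≤ l → t ≤ t' →
  step f k t' (step f l t τ) ⊑ step f l t' (step f k t τ)
steps-exchange {τ} {σ} f f-mono {k} {l} t t' τ↭klσ k≤l t≤t' =
  ≼⇒⊑ (≼-resp-↭ late-small early-small (≼-++ {σ} {σ} (λ _ → ≤-refl) (spawn-exchange f f-mono k≤l t≤t')))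
  where
  late-small : step f k t' (step f l t τ) ↭ σ ++ (spawn f l t ++ spawn f k t')
  late-small = ↭-trans (steps-cancel f t t' (↭-trans τ↭klσ (swap k l ↭-refl))) (++-assoc σ _ _)
  early-small : step f l t' (step f k t τ) ↭ σ ++ (spawn f k t ++ spawn f l t')
  early-small = ↭-trans (steps-cancel f t t' τ↭klσ) (++-assoc σ _ _)

crossing : ∀ (g : ℕ → ℕ) j n x → j < g x → g (n + x) ≤ j →
  ∃ λ l → x ≤ l × j < g l × g (suc l) ≤ j
crossing g j zero    x j<gx gx≤j = contradiction gx≤j (<⇒≱ j<gx)
crossing g j (suc n) x j<gx gn+x≤j with g (suc x) ≤? j
... | yes gsx≤j = x , ≤-refl , j<gx , gsx≤j
... | no gsx≰j with crossing g j n (suc x) (≰⇒> gsx≰j) (subst (λ m → g m ≤ j) (sym (+-suc n x)) gn+x≤j)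
...   | l , sx≤l , j<gl , gsl≤j = l , ≤-trans (n≤1+n x) sx≤l , j<gl , gsl≤j

remove-≼ : τ ≼ τ' → k ∈ τ → l ∈ τ' → k ≤ l → count≥ (suc k) τ < count≥ l τ' →
  remove k τ ≼ remove l τ'
remove-≼ {τ} {τ'} {k} {l} τ≼τ' k∈τ l∈τ' k≤l gap x with x ≤? k | x ≤? l
... | yes x≤k | _ = s≤s⁻¹ (subst₂ _≤_ (count≥-remove-below k∈τ x≤k)
                            (count≥-remove-below l∈τ' (≤-trans x≤k k≤l)) (τ≼τ' x))
... | no x≰k | yes x≤l = s≤s⁻¹ (begin
  suc (count≥ x (remove k τ))     ≡⟨ cong suc (count≥-remove-above k∈τ (≰⇒> x≰k)) ⟨
  suc (count≥ x τ)                ≤⟨ s≤s (count≥-antitone τ (≰⇒> x≰k)) ⟩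
  suc (count≥ (suc k) τ)          ≤⟨ gap ⟩
  count≥ l τ'                     ≤⟨ count≥-antitone τ' x≤l ⟩
  count≥ x τ'                     ≡⟨ count≥-remove-below l∈τ' x≤l ⟩
  suc (count≥ x (remove l τ'))    ∎)
  where open ≤-Reasoning
... | no x≰k | no x≰l = subst₂ _≤_ (count≥-remove-above k∈τ (≰⇒> x≰k))
                          (count≥-remove-above l∈τ' (≰⇒> x≰l)) (τ≼τ' x)

-- If τ ≼ τ' and k ∈ τ, a partner l ≥ k can be removed from τ' in parallel:
-- l is the point where the count function of τ' falls to count≥ (k + 1) τ.
dominated-removal : τ ≼ τ' → k ∈ τ → ∃ λ l → l ∈ τ' × k ≤ l × remove k τ ≼ remove l τ'
dominated-removal {τ} {τ'} {k} τ≼τ' k∈τ =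
  partner (crossing (λ y → count≥ y τ') level (suc (sum τ')) k level<k vanishing)
  where
  level : ℕ
  level = count≥ (suc k) τ
  level<k : level < count≥ k τ'
  level<k = <-≤-trans (∈⇒count≥-drops k∈τ) (τ≼τ' k)
  vanishing : count≥ (suc (sum τ') + k) τ' ≤ level
  vanishing = ≤-trans (count≥-antitone τ' (m≤m+n (suc (sum τ')) k))
                      (subst (_≤ level) (sym (count≥-beyond-sum τ')) z≤n)
  partner : (∃ λ l → k ≤ l × level < count≥ l τ' × count≥ (suc l) τ' ≤ level) →
            ∃ λ l → l ∈ τ' × k ≤ l × remove k τ ≼ remove l τ'
  partner (l , k≤l , level<l , sl≤level) =
    l , l∈τ' , k≤l , remove-≼ τ≼τ' k∈τ l∈τ' k≤l level<l
    where
    l∈τ' : l ∈ τ'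
    l∈τ' = count≥-drops⇒∈ τ' (≤-<-trans sl≤level level<l)

-- Part 5: the partner of dominated-removal also dominates the spawns.
step-dominated : ∀ f t → τ ≼ τ' → k ∈ τ → ∃ λ l → l ∈ τ' × k ≤ l × step f k t τ ⊑ step f l t τ'
step-dominated {τ} {τ'} {k} f t τ≼τ' k∈τ with dominated-removal τ≼τ' k∈τ
... | l , l∈τ' , k≤l , remove≼ = l , l∈τ' , k≤l ,
  ≼⇒⊑ (≼-resp-↭ (step-normal f k t τ) (step-normal f l t τ') (≼-++ {remove k τ} {remove l τ'} remove≼ (spawn-≼ f t k≤l)))

increasing⇒monotone : ∀ {f} → Increasing f → f Preserves _≤_ ⟶ _≤_
increasing⇒monotone f-inc t≤t' with m≤n⇒m<n∨m≡n t≤t'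
... | inj₁ t<t' = <⇒≤ (f-inc t<t')
... | inj₂ refl = ≤-refl

lemma4 : (f : ℕ → ℕ) → Increasing f → 0 < f 0 →
    (∀ (τ : Type) (k t : ℕ) → k ∈ τ → step f k t τ <ₘ τ)
    × (∀ (τ τ' : Type) (k t : ℕ) → k ∈ τ → τ ⊆ₘ τ' → step f k t τ ⊆ₘ step f k t τ')
    × (∀ (τ : Type) (k l t t' : ℕ) → (k ∷ l ∷ []) ⊆ₘ τ →
         step f k t' (step f l t τ) ↭ step f l t (step f k t' τ))
    × (∀ (τ : Type) (k l t t' : ℕ) → (k ∷ l ∷ []) ⊆ₘ τ → k ≤ l → t ≤ t' →
         step f k t' (step f l t τ) ⊑ step f l t' (step f k t τ))
    × (∀ (τ τ' : Type) (k t : ℕ) → τ ⊑ τ' → k ∈ τ →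
         ∃ λ l → l ∈ τ' × k ≤ l × step f k t τ ⊑ step f l t τ')
lemma4 f f-inc _ =
    (λ τ k t → step-decreases f t)
  , (λ τ τ' k t → step-⊆ₘ f t)
  , (λ { τ k l t t' (σ , τ↭klσ) → steps-commute f t t' τ↭klσ })
  , (λ { τ k l t t' (σ , τ↭klσ) → steps-exchange f (increasing⇒monotone f-inc) t t' τ↭klσ })
  , (λ τ τ' k t τ⊑τ' → step-dominated f t (⊑⇒≼ τ⊑τ'))
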